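{- For any finite simple graph $G$ with $n$ vertices having at least two disjoint edges, $\Gamma(G)+1 \leq d_0(G) \leq \min\{n-1, \Gamma(G)+\gamma(G)\}$.
   Context: A set $S \subseteq V(G)$ is a dominating set of $G$ if every vertex of $V(G)\setminus S$ is adjacent to a vertex of $S$; it is minimal if no proper subset is a dominating set. $\gamma(G)$ is the minimum cardinality of a dominating set of $G$, and $\Gamma(G)$ is the maximum cardinality of a minimal dominating set of $G$. For an integer $k \geq \gamma(G)$, the $k$-dominating graph $D_k(G)$ is the graph whose vertices are the dominating sets of $G$ of cardinality at most $k$, two such sets $A,B$ being adjacent if and only if their symmetric difference $(A\setminus B)\cup(B\setminus A)$ consists of exactly one vertex of $G$. $d_0(G)$ denotes the smallest integer $d \geq \gamma(G)$ such that $D_k(G)$ is connected for every integer $k \geq d$. -}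

module Defs where

open import Data.Nat using (ℕ; _≤_; _<_)
open import Data.Fin using (Fin)
open import Data.Fin.Subset using (Subset; _∈_; _∉_; _⊂_; ∣_∣)
open import Data.Vec using (lookup)
open import Data.Product using (Σ; ∃; _×_; _,_)
open import Relation.Nullary using (¬_)
open import Relation.Binary.PropositionalEquality using (_≡_; _≢_)

record Graph (n : ℕ) : Set₁ where
  field
    Adj     : Fin n → Fin n → Set
    symAdj  : ∀ {u v} → Adj u v → Adj v u
    irrefl  : ∀ {v} → ¬ Adj v v

module _ {n : ℕ} (G : Graph n) where
  open Graph G

  HasTwoDisjointEdges : Set
  HasTwoDisjointEdges =
    Σ (Fin n) λ a → Σ (Fin n) λ b → Σ (Fin n) λ c → Σ (Fin n) λ d →
      Adj a b × Adj c d ×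
      a ≢ c × a ≢ d × b ≢ c × b ≢ d

  Dominating : Subset n → Set
  Dominating S = ∀ v → v ∉ S → ∃ λ u → u ∈ S × Adj u v

  MinimalDominating : Subset n → Set
  MinimalDominating S = Dominating S × (∀ T → T ⊂ S → ¬ Dominating T)

  IsDomNumber : ℕ → Set
  IsDomNumber g =
    (∃ λ S → Dominating S × ∣ S ∣ ≡ g) × (∀ S → Dominating S → g ≤ ∣ S ∣)

  IsUpperDomNumber : ℕ → Set
  IsUpperDomNumber m =
    (∃ λ S → MinimalDominating S × ∣ S ∣ ≡ m) ×
    (∀ S → MinimalDominating S → ∣ S ∣ ≤ m)

  -- vertices of D_k(G): dominating sets of cardinality at most k
  InDk : ℕ → Subset n → Set
  InDk k S = Dominating S × ∣ S ∣ ≤ k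

  DifferByOne : Subset n → Subset n → Set
  DifferByOne A B =
    ∃ λ v → (lookup A v ≢ lookup B v) × (∀ w → w ≢ v → lookup A w ≡ lookup B w)

  data Walk (k : ℕ) : Subset n → Subset n → Set where
    here : ∀ {A} → Walk k A A
    step : ∀ {A B C} → DifferByOne A B → InDk k B → Walk k B C → Walk k A C

  DkConnected : ℕ → Set
  DkConnected k = ∀ A B → InDk k A → InDk k B → Walk k A B

  IsD0 : ℕ → ℕ → Set
  IsD0 g d =
    g ≤ d × (∀ k → d ≤ k → DkConnected k) ×
    (∀ d' → g ≤ d' → (∀ k → d' ≤ k → DkConnected k) → d ≤ d')

module Submission where

-- The engine is the interval lemma: if Lo ⊆ Hi, Lo is dominating and |Hi| ≤ k,
-- then any two sets between Lo and Hi are joined in D_k(G), by correcting one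
-- vertex at a time (every intermediate set stays between Lo and Hi).  Two
-- dominating sets inside a common set of size ≤ k are then joined through their
-- union, and D_k(G) is connected as soon as all its vertices reach a common hub.
--
--  * d₀ ≤ Γ+γ: every A in D_k shrinks to a minimal dominating M ⊆ A, and M reaches
--    a minimum dominating set D inside M ∪ D, of size ≤ Γ+γ.
--  * d₀ ≤ n-1: every A in D_k misses a vertex x, so A reaches V-x; the two
--    disjoint edges let V-x hop (through V-{x,t}) to the hub V-a.
--  * Γ+1 ≤ d₀: a minimal dominating set of size Γ is isolated in D_Γ, and another
--    minimal dominating set exists (one through, one avoiding an end of an edge).
--
-- Producing minimal dominating sets requires decidable adjacency; since the goal
-- is a decidable statement about ℕ and the vertex set is finite, this may be
-- assumed by double negation.

open import Defs
open import Data.Nat using (ℕ; zero; suc; _≤_; _<_; _+_; _∸_; _⊓_; z≤n; s≤s)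
open import Data.Nat.Properties as ℕₚ using (≤-trans; _≤?_)
open import Data.Bool.Properties using () renaming (_≟_ to _≟ᵇ_)
open import Data.Fin using (Fin)
import Data.Fin as Fin
open import Data.Fin.Properties using (all?; any?; ¬∀⟶∃¬) renaming (_≟_ to _≟ᶠ_)
open import Data.Fin.Subset
  using (Subset; inside; outside; _∈_; _∉_; _⊆_; _⊂_; ∣_∣; ⊤; _∪_; _─_; _-_; ⁅_⁆)
open import Data.Fin.Subset.Properties
  using ( _∈?_; ∈⊤; ∣⊤∣≡n; x∈⁅x⁆; ⊆-refl; ⊆-trans; p⊆q⇒∣p∣≤∣q∣; p⊂q⇒∣p∣<∣q∣
        ; x∈p∪q⁻; p⊆p∪q; q⊆p∪q; p─q⊆p; x∈p∧x≢y⇒x∈p-y; x∈p⇒∣p-x∣<∣p∣ )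
open import Data.Vec using ([]; _∷_; lookup; tabulate; _[_]≔_)
open import Data.Vec.Base using (here; there)
open import Data.Vec.Properties
  using (lookup∘update; lookup∘update′; lookup∘tabulate; tabulate∘lookup; tabulate-cong; []=⇒lookup; lookup⇒[]=)
open import Data.List using (List; []; _∷_; allFin)
import Data.List.Relation.Unary.Any as Any
open import Data.List.Relation.Unary.Any.Properties using (¬Any[])
open import Data.List.Membership.Propositional using () renaming (_∈_ to _∈ₗ_)
open import Data.List.Membership.Propositional.Properties using (∈-allFin)
open import Data.Product using (∃; _×_; _,_; proj₁; proj₂)
open import Data.Sum using (_⊎_; inj₁; inj₂; [_,_]′)
open import Data.Empty using (⊥-elim)
open import Relation.Nullary using (¬_; Dec; yes; no; does)
open import Relation.Nullary.Decidable
  using (¬?; _×-dec_; _→-dec_; dec-true; dec-false; decidable-stable; ¬¬-excluded-middle)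
open import Relation.Binary.PropositionalEquality
  using (_≡_; _≢_; refl; sym; trans; subst; ≢-sym; module ≡-Reasoning)

outside≢inside : outside ≢ inside
outside≢inside ()

subset-ext : ∀ {m} {X Y : Subset m} → (∀ w → lookup X w ≡ lookup Y w) → X ≡ Y
subset-ext {X = X} {Y} same = begin
  X                   ≡⟨ sym (tabulate∘lookup X) ⟩
  tabulate (lookup X) ≡⟨ tabulate-cong same ⟩
  tabulate (lookup Y) ≡⟨ tabulate∘lookup Y ⟩
  Y                   ∎
  where open ≡-Reasoning

∣p∪q∣≤∣p∣+∣q∣ : ∀ {m} (p q : Subset m) → ∣ p ∪ q ∣ ≤ ∣ p ∣ + ∣ q ∣
∣p∪q∣≤∣p∣+∣q∣ [] [] = z≤n
∣p∪q∣≤∣p∣+∣q∣ (inside ∷ p) (inside ∷ q) =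
  s≤s (≤-trans (∣p∪q∣≤∣p∣+∣q∣ p q) (ℕₚ.+-monoʳ-≤ ∣ p ∣ (ℕₚ.n≤1+n _)))
∣p∪q∣≤∣p∣+∣q∣ (inside ∷ p) (outside ∷ q) = s≤s (∣p∪q∣≤∣p∣+∣q∣ p q)
∣p∪q∣≤∣p∣+∣q∣ (outside ∷ p) (inside ∷ q) =
  subst (suc ∣ p ∪ q ∣ ≤_) (sym (ℕₚ.+-suc ∣ p ∣ ∣ q ∣)) (s≤s (∣p∪q∣≤∣p∣+∣q∣ p q))
∣p∪q∣≤∣p∣+∣q∣ (outside ∷ p) (outside ∷ q) = ∣p∪q∣≤∣p∣+∣q∣ p q

x∈p─q⇒x∉q : ∀ {m} (p q : Subset m) {x} → x ∈ p ─ q → x ∉ q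
x∈p─q⇒x∉q (_ ∷ p) (outside ∷ q) here ()
x∈p─q⇒x∉q (_ ∷ p) (_ ∷ q) (there x∈p─q) (there x∈q) = x∈p─q⇒x∉q p q x∈p─q x∈q

x∈p-y⇒x≢y : ∀ {m} {p : Subset m} {x y} → x ∈ p - y → x ≢ y
x∈p-y⇒x≢y {p = p} {y = y} x∈p-y refl = x∈p─q⇒x∉q p ⁅ y ⁆ x∈p-y (x∈⁅x⁆ y)

p⊆q⇒p-x⊆q-x : ∀ {m} {p q : Subset m} {x} → p ⊆ q → p - x ⊆ q - x
p⊆q⇒p-x⊆q-x {p = p} {x = x} p⊆q w∈ = x∈p∧x≢y⇒x∈p-y (p⊆q (p─q⊆p p ⁅ x ⁆ w∈)) (x∈p-y⇒x≢y w∈)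

¬¬-∀Fin : ∀ {m} {P : Fin m → Set} → (∀ i → ¬ ¬ P i) → ¬ ¬ (∀ i → P i)
¬¬-∀Fin {zero} _ ¬all = ¬all λ ()
¬¬-∀Fin {suc m} {P} ¬¬P ¬all =
  ¬¬P Fin.zero λ p₀ → ¬¬-∀Fin (λ i → ¬¬P (Fin.suc i)) λ pₛ → ¬all (cons p₀ pₛ)
  where
  cons : P Fin.zero → (∀ i → P (Fin.suc i)) → ∀ i → P i
  cons p₀ pₛ Fin.zero = p₀
  cons p₀ pₛ (Fin.suc i) = pₛ i

module _ {n : ℕ} (G : Graph n) where
  open Graph G

  adj⇒≢ : ∀ {u v} → Adj u v → u ≢ v
  adj⇒≢ uv refl = irrefl uv

  dominating-⊇ : ∀ {S T} → S ⊆ T → Dominating G S → Dominating G T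
  dominating-⊇ S⊆T dS v v∉T with dS v (λ v∈S → v∉T (S⊆T v∈S))
  ... | u , u∈S , uv = u , S⊆T u∈S , uv

  _++ʷ_ : ∀ {k A B C} → Walk G k A B → Walk G k B C → Walk G k A C
  here ++ʷ q = q
  step δ iB p ++ʷ q = step δ iB (p ++ʷ q)

  differByOne-sym : ∀ {A B : Subset n} → DifferByOne G A B → DifferByOne G B A
  differByOne-sym (v , differ , same) = v , ≢-sym differ , λ w w≢v → sym (same w w≢v)

  reverse : ∀ {k A B} → InDk G k A → Walk G k A B → Walk G k B A
  reverse iA here = here
  reverse {A = A} iA (step {B = B} δ iB w) = reverse iB w ++ʷ step (differByOne-sym {A} {B} δ) iA here

  connected-via-hub : ∀ {k} H → (∀ A → InDk G k A → Walk G k A H) → DkConnected G k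
  connected-via-hub H toHub A B iA iB = toHub A iA ++ʷ reverse iB (toHub B iB)

  Between : Subset n → Subset n → Subset n → Set
  Between Lo Hi X = Lo ⊆ X × X ⊆ Hi

  between-pointwise : ∀ {Lo Hi X Y} Z → Between Lo Hi X → Between Lo Hi Y →
    (∀ w → lookup Z w ≡ lookup X w ⊎ lookup Z w ≡ lookup Y w) → Between Lo Hi Z
  between-pointwise {Lo} {Hi} Z (Lo⊆X , X⊆Hi) (Lo⊆Y , Y⊆Hi) choice = Lo⊆Z , Z⊆Hi
    where
    Lo⊆Z : Lo ⊆ Z
    Lo⊆Z {w} w∈Lo with choice w
    ... | inj₁ e = lookup⇒[]= w Z (trans e ([]=⇒lookup (Lo⊆X w∈Lo)))
    ... | inj₂ e = lookup⇒[]= w Z (trans e ([]=⇒lookup (Lo⊆Y w∈Lo)))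
    Z⊆Hi : Z ⊆ Hi
    Z⊆Hi {w} w∈Z with choice w
    ... | inj₁ e = X⊆Hi (lookup⇒[]= w _ (trans (sym e) ([]=⇒lookup w∈Z)))
    ... | inj₂ e = Y⊆Hi (lookup⇒[]= w _ (trans (sym e) ([]=⇒lookup w∈Z)))

  narrow : ∀ {X Y : Subset n} {v L} → lookup X v ≡ lookup Y v →
    (∀ w → lookup X w ≢ lookup Y w → w ∈ₗ v ∷ L) → (∀ w → lookup X w ≢ lookup Y w → w ∈ₗ L)
  narrow agree diffs w differ with diffs w differ
  ... | Any.here refl = ⊥-elim (differ agree)
  ... | Any.there w∈L = w∈L

  module _ {k : ℕ} {Lo Hi : Subset n} (dLo : Dominating G Lo) (Hi≤k : ∣ Hi ∣ ≤ k) where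

    between-inDk : ∀ {X} → Between Lo Hi X → InDk G k X
    between-inDk (Lo⊆X , X⊆Hi) = dominating-⊇ Lo⊆X dLo , ≤-trans (p⊆q⇒∣p∣≤∣q∣ X⊆Hi) Hi≤k

    correct : ∀ {Y} → Between Lo Hi Y → ∀ L X → Between Lo Hi X →
      (∀ w → lookup X w ≢ lookup Y w → w ∈ₗ L) → Walk G k X Y
    correct {Y} bY [] X bX diffs = subst (Walk G k X) (subset-ext agree) here
      where
      agree : ∀ w → lookup X w ≡ lookup Y w
      agree w = decidable-stable (lookup X w ≟ᵇ lookup Y w) (λ differ → ¬Any[] (diffs w differ))
    correct {Y} bY (v ∷ L) X bX diffs with lookup X v ≟ᵇ lookup Y v
    ... | yes agree = correct bY L X bX (narrow {X} {Y} agree diffs)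
    ... | no differ =
      step (v , moved , unmoved) (between-inDk bX′)
        (correct bY L X′ bX′ (narrow {X′} {Y} (lookup∘update v X _) diffs′))
      where
      X′ : Subset n
      X′ = X [ v ]≔ lookup Y v
      moved : lookup X v ≢ lookup X′ v
      moved e = differ (trans e (lookup∘update v X _))
      unmoved : ∀ w → w ≢ v → lookup X w ≡ lookup X′ w
      unmoved w w≢v = sym (lookup∘update′ w≢v X _)
      bX′ : Between Lo Hi X′
      bX′ = between-pointwise X′ bX bY choice
        where
        choice : ∀ w → lookup X′ w ≡ lookup X w ⊎ lookup X′ w ≡ lookup Y w
        choice w with w ≟ᶠ v
        ... | yes refl = inj₂ (lookup∘update v X _)
        ... | no w≢v = inj₁ (lookup∘update′ w≢v X _)
      diffs′ : ∀ w → lookup X′ w ≢ lookup Y w → w ∈ₗ v ∷ L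
      diffs′ w differ′ with w ≟ᶠ v
      ... | yes refl = Any.here refl
      ... | no w≢v = diffs w (λ e → differ′ (trans (lookup∘update′ w≢v X _) e))

    interval : ∀ {X Y} → Between Lo Hi X → Between Lo Hi Y → Walk G k X Y
    interval {X} bX bY = correct bY (allFin n) X bX (λ w _ → ∈-allFin w)

  bridge : ∀ {k X Y Hi} → Dominating G X → Dominating G Y → X ⊆ Hi → Y ⊆ Hi → ∣ Hi ∣ ≤ k →
    Walk G k X Y
  bridge {X = X} {Y} {Hi} dX dY X⊆Hi Y⊆Hi Hi≤k =
    interval dX Hi≤k (⊆-refl , X⊆Hi) (p⊆p∪q Y , X∪Y⊆Hi)
    ++ʷ interval dY Hi≤k (q⊆p∪q X Y , X∪Y⊆Hi) (⊆-refl , Y⊆Hi)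
    where
    X∪Y⊆Hi : X ∪ Y ⊆ Hi
    X∪Y⊆Hi w∈ = [ X⊆Hi , Y⊆Hi ]′ (x∈p∪q⁻ X Y w∈)

  grown-at : ∀ {A B : Subset n} {v} → lookup A v ≡ outside → lookup B v ≡ inside →
    (∀ w → w ≢ v → lookup A w ≡ lookup B w) → A ⊂ B
  grown-at {A} {B} {v} Av Bv same = A⊆B , v , lookup⇒[]= v B Bv , v∉A
    where
    v∉A : v ∉ A
    v∉A v∈A = outside≢inside (trans (sym Av) ([]=⇒lookup v∈A))
    A⊆B : A ⊆ B
    A⊆B {w} w∈A with w ≟ᶠ v
    ... | yes refl = ⊥-elim (v∉A w∈A)
    ... | no w≢v = lookup⇒[]= w B (trans (sym (same w w≢v)) ([]=⇒lookup w∈A))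

  differByOne-⊂ : ∀ {A B : Subset n} → DifferByOne G A B → A ⊂ B ⊎ B ⊂ A
  differByOne-⊂ {A} {B} (v , differ , same) with lookup A v in eA | lookup B v in eB
  ... | outside | inside = inj₁ (grown-at {A} {B} eA eB same)
  ... | inside | outside = inj₂ (grown-at {B} {A} eB eA (λ w w≢v → sym (same w w≢v)))
  ... | inside | inside = ⊥-elim (differ refl)
  ... | outside | outside = ⊥-elim (differ refl)

  -- A minimal dominating set of size k is an isolated vertex of D_k(G): its
  -- subsets are not dominating and its proper supersets are too large.
  minimal-isolated : ∀ {k S B} → MinimalDominating G S → ∣ S ∣ ≡ k → Walk G k S B → S ≡ B
  minimal-isolated mS ∣S∣≡k here = refl
  minimal-isolated mS ∣S∣≡k (step {B = C} δ (dC , ∣C∣≤k) _) with differByOne-⊂ δ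
  ... | inj₁ S⊂C = ⊥-elim (ℕₚ.<⇒≱ (p⊂q⇒∣p∣<∣q∣ S⊂C) (subst (∣ C ∣ ≤_) (sym ∣S∣≡k) ∣C∣≤k))
  ... | inj₂ C⊂S = ⊥-elim (proj₂ mS C C⊂S dC)

  allBut : Fin n → Subset n
  allBut x = ⊤ - x

  ∈allBut : ∀ {x v} → v ≢ x → v ∈ allBut x
  ∈allBut v≢x = x∈p∧x≢y⇒x∈p-y ∈⊤ v≢x

  ∣allBut∣ : ∀ x → ∣ allBut x ∣ ≤ n ∸ 1
  ∣allBut∣ x = ℕₚ.∸-monoˡ-≤ 1 (subst (∣ allBut x ∣ <_) (∣⊤∣≡n n) (x∈p⇒∣p-x∣<∣p∣ (∈⊤ {x = x})))

  allBut-dominating : ∀ {x y} → Adj y x → Dominating G (allBut x)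
  allBut-dominating {x} yx v v∉ with v ≟ᶠ x
  ... | yes refl = _ , ∈allBut (adj⇒≢ yx) , yx
  ... | no v≢x = ⊥-elim (v∉ (∈allBut v≢x))

  -- For k ≥ n-1, V-x and V-t are joined in D_k(G) through V-{x,t}, provided x
  -- has a neighbour y ≠ t and t has a neighbour z ≠ x.
  hop : ∀ {k} → n ∸ 1 ≤ k → ∀ {x t y z} → Adj y x → Adj z t → y ≢ t → z ≢ x →
    Walk G k (allBut x) (allBut t)
  hop n-1≤k {x} {t} {y} {z} yx zt y≢t z≢x =
    interval dLo (≤-trans (∣allBut∣ x) n-1≤k) (Lo⊆x , ⊆-refl) (⊆-refl , Lo⊆x)
    ++ʷ interval dLo (≤-trans (∣allBut∣ t) n-1≤k) (⊆-refl , Lo⊆t) (Lo⊆t , ⊆-refl)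
    where
    Lo : Subset n
    Lo = allBut x - t
    Lo⊆x : Lo ⊆ allBut x
    Lo⊆x = p─q⊆p (allBut x) ⁅ t ⁆
    Lo⊆t : Lo ⊆ allBut t
    Lo⊆t w∈ = ∈allBut (x∈p-y⇒x≢y w∈)
    dLo : Dominating G Lo
    dLo v v∉ with v ≟ᶠ x | v ≟ᶠ t
    ... | yes refl | _ = y , x∈p∧x≢y⇒x∈p-y (∈allBut (adj⇒≢ yx)) y≢t , yx
    ... | no _ | yes refl = z , x∈p∧x≢y⇒x∈p-y (∈allBut z≢x) (adj⇒≢ zt) , zt
    ... | no v≢x | no v≢t = ⊥-elim (v∉ (x∈p∧x≢y⇒x∈p-y (∈allBut v≢x) v≢t))

  module ReachHub {k : ℕ} (n-1≤k : n ∸ 1 ≤ k) {a b c e : Fin n} (ab : Adj a b) (ce : Adj c e)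
                  (a≢c : a ≢ c) (a≢e : a ≢ e) (b≢c : b ≢ c) (b≢e : b ≢ e) where

    c→a : Walk G k (allBut c) (allBut a)
    c→a = hop n-1≤k (symAdj ce) (symAdj ab) (≢-sym a≢e) b≢c

    e→a : Walk G k (allBut e) (allBut a)
    e→a = hop n-1≤k ce (symAdj ab) (≢-sym a≢c) b≢e

    b→a : Walk G k (allBut b) (allBut a)
    b→a = hop n-1≤k ab (symAdj ce) a≢c (≢-sym b≢e) ++ʷ c→a

    -- Either hop to a directly, or first to b (when y = a, which blocks the
    -- direct hop), or, when x = b, first to c or e.
    reach : ∀ {x y} → Adj y x → Walk G k (allBut x) (allBut a)
    reach {x} {y} yx with x ≟ᶠ a | y ≟ᶠ a | x ≟ᶠ b
    ... | yes refl | _ | _ = here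
    ... | no x≢a | no y≢a | no x≢b = hop n-1≤k yx (symAdj ab) y≢a (≢-sym x≢b)
    ... | no x≢a | yes refl | no x≢b = hop n-1≤k yx ab (adj⇒≢ ab) (≢-sym x≢a) ++ʷ b→a
    ... | no x≢a | yes refl | yes refl = b→a
    ... | no x≢a | no y≢a | yes refl with y ≟ᶠ c
    ...   | yes refl = hop n-1≤k yx ce (adj⇒≢ ce) (≢-sym b≢c) ++ʷ e→a
    ...   | no y≢c = hop n-1≤k yx (symAdj ce) y≢c (≢-sym b≢e) ++ʷ c→a

  -- Upper bound n-1: with two disjoint edges, D_k(G) is connected for every
  -- k ≥ n-1.  A set of size ≤ n-1 misses a vertex x and so lies below V-x.
  connected-above-n-1 : HasTwoDisjointEdges G → ∀ k → n ∸ 1 ≤ k → DkConnected G k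
  connected-above-n-1 (a , b , c , e , ab , ce , a≢c , a≢e , b≢c , b≢e) k n-1≤k =
    connected-via-hub (allBut a) toHub
    where
    open ReachHub n-1≤k ab ce a≢c a≢e b≢c b≢e
    toHub : ∀ A → InDk G k A → Walk G k A (allBut a)
    toHub A (dA , ∣A∣≤k) with all? (_∈? A)
    -- A = V lies above the dominating set V-a
    ... | yes full = interval (allBut-dominating (symAdj ab)) ∣A∣≤k
                       ((λ {w} _ → full w) , ⊆-refl) (⊆-refl , (λ {w} _ → full w))
    ... | no ¬full with ¬∀⟶∃¬ n (_∈ A) (_∈? A) ¬full
    ...   | x , x∉A with dA x x∉A
    ...     | u , u∈A , ux =
      interval dA (≤-trans (∣allBut∣ x) n-1≤k) (⊆-refl , A⊆x) (A⊆x , ⊆-refl) ++ʷ reach ux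
      where
      A⊆x : A ⊆ allBut x
      A⊆x w∈A = ∈allBut λ { refl → x∉A w∈A }

  -- Hence d₀ ≤ n-1 (note γ ≤ |V-a| ≤ n-1 as V-a is dominating).
  d₀≤n-1 : HasTwoDisjointEdges G → ∀ {γ d} → IsDomNumber G γ → IsD0 G γ d → d ≤ n ∸ 1
  d₀≤n-1 two@(a , b , _ , _ , ab , _) {γ} (_ , γ-min) (_ , _ , d-min) =
    d-min (n ∸ 1) γ≤n-1 (connected-above-n-1 two)
    where
    γ≤n-1 : γ ≤ n ∸ 1
    γ≤n-1 = ≤-trans (γ-min (allBut a) (allBut-dominating (symAdj ab))) (∣allBut∣ a)

  module WithDecidableAdjacency (adj? : ∀ u v → Dec (Adj u v)) where

    dominating? : ∀ S → Dec (Dominating G S)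
    dominating? S = all? λ v → ¬? (v ∈? S) →-dec any? (λ u → (u ∈? S) ×-dec adj? u v)

    prune : (L : List (Fin n)) (Y : Subset n) → Dominating G Y →
      ∃ λ M → M ⊆ Y × Dominating G M × (∀ v → v ∈ₗ L → v ∈ M → ¬ Dominating G (M - v))
    prune [] Y dY = Y , ⊆-refl , dY , λ _ ()
    prune (x ∷ L) Y dY with dominating? (Y - x)
    ... | yes dY-x =
      let M , M⊆Y-x , dM , indispensable = prune L (Y - x) dY-x in
      M , ⊆-trans M⊆Y-x (p─q⊆p Y ⁅ x ⁆) , dM ,
      λ { _ (Any.here refl) x∈M → ⊥-elim (x∈p-y⇒x≢y (M⊆Y-x x∈M) refl)
        ; v (Any.there v∈L) → indispensable v v∈L }
    ... | no ¬dY-x =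
      let M , M⊆Y , dM , indispensable = prune L Y dY in
      M , M⊆Y , dM ,
      λ { _ (Any.here refl) _ dM-x → ¬dY-x (dominating-⊇ (p⊆q⇒p-x⊆q-x M⊆Y) dM-x)
        ; v (Any.there v∈L) → indispensable v v∈L }

    minimal-⊆ : ∀ X → Dominating G X → ∃ λ M → M ⊆ X × MinimalDominating G M
    minimal-⊆ X dX =
      let M , M⊆X , dM , indispensable = prune (allFin n) X dX in
      M , M⊆X , dM ,
      λ T (T⊆M , x , x∈M , x∉T) dT →
        indispensable x (∈-allFin x) x∈M
          (dominating-⊇ (λ w∈T → x∈p∧x≢y⇒x∈p-y (T⊆M w∈T) λ { refl → x∉T w∈T }) dT)

    -- The vertices not adjacent to a (a itself included); a dominating set.
    nonNeighbours : Fin n → Subset n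
    nonNeighbours a = tabulate λ w → does (¬? (adj? a w))

    ∈nonNeighbours⁺ : ∀ {a w} → ¬ Adj a w → w ∈ nonNeighbours a
    ∈nonNeighbours⁺ {a} {w} ¬aw =
      lookup⇒[]= w _ (trans (lookup∘tabulate _ w) (dec-true (¬? (adj? a w)) ¬aw))

    ∈nonNeighbours⁻ : ∀ {a w} → w ∈ nonNeighbours a → ¬ Adj a w
    ∈nonNeighbours⁻ {a} {w} w∈ aw = outside≢inside (sym (begin
      inside                          ≡⟨ sym ([]=⇒lookup w∈) ⟩
      lookup (nonNeighbours a) w      ≡⟨ lookup∘tabulate _ w ⟩
      does (¬? (adj? a w))            ≡⟨ dec-false (¬? (adj? a w)) (λ ¬aw → ¬aw aw) ⟩
      outside                         ∎))
      where open ≡-Reasoning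

    -- Every vertex a lies in a minimal dominating set: a minimal dominating
    -- subset of the non-neighbours of a must contain a to dominate it.
    minimal-∋ : ∀ a → ∃ λ M → MinimalDominating G M × a ∈ M
    minimal-∋ a with minimal-⊆ (nonNeighbours a) dN
      where
      dN : Dominating G (nonNeighbours a)
      dN v v∉ with adj? a v
      ... | yes av = a , ∈nonNeighbours⁺ irrefl , av
      ... | no ¬av = ⊥-elim (v∉ (∈nonNeighbours⁺ ¬av))
    ... | M , M⊆N , mM with a ∈? M
    ...   | yes a∈M = M , mM , a∈M
    ...   | no a∉M with proj₁ mM a a∉M
    ...     | u , u∈M , ua = ⊥-elim (∈nonNeighbours⁻ (M⊆N u∈M) (symAdj ua))

    -- A vertex a with a neighbour avoids some minimal dominating set (one inside V-a).
    minimal-∌ : ∀ {a b} → Adj b a → ∃ λ M → MinimalDominating G M × a ∉ M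
    minimal-∌ {a} ba =
      let M , M⊆V-a , mM = minimal-⊆ (allBut a) (allBut-dominating ba) in
      M , mM , λ a∈M → x∈p-y⇒x≢y (M⊆V-a a∈M) refl

    minimal-≢ : ∀ {a b} → Adj b a → ∀ S → ∃ λ M → MinimalDominating G M × S ≢ M
    minimal-≢ {a} ba S with a ∈? S
    ... | yes a∈S = let M , mM , a∉M = minimal-∌ ba in M , mM , λ { refl → a∉M a∈S }
    ... | no a∉S = let M , mM , a∈M = minimal-∋ a in M , mM , λ { refl → a∉S a∈M }

    -- Lower bound: if G has an edge, D_Γ(G) is disconnected, hence Γ < d₀.
    Γ<d₀ : ∀ {a b γ Γ d} → Adj a b → IsUpperDomNumber G Γ → IsD0 G γ d → Γ + 1 ≤ d
    Γ<d₀ {Γ = Γ} {d} ab ((S , mS , ∣S∣≡Γ) , Γ-max) (_ , conn , _) with d ≤? Γ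
    ... | no d≰Γ = subst (_≤ d) (ℕₚ.+-comm 1 Γ) (ℕₚ.≰⇒> d≰Γ)
    ... | yes d≤Γ =
      let M , mM , S≢M = minimal-≢ (symAdj ab) S in
      ⊥-elim (S≢M (minimal-isolated mS ∣S∣≡Γ
        (conn Γ d≤Γ S M (proj₁ mS , ℕₚ.≤-reflexive ∣S∣≡Γ) (proj₁ mM , Γ-max M mM))))

    -- Upper bound Γ+γ: every A in D_k shrinks to a minimal dominating M ⊆ A,
    -- and M reaches a minimum dominating set D inside M ∪ D.
    d₀≤Γ+γ : ∀ {γ Γ d} → IsDomNumber G γ → IsUpperDomNumber G Γ → IsD0 G γ d → d ≤ Γ + γ
    d₀≤Γ+γ {γ} {Γ} ((D , dD , ∣D∣≡γ) , _) (_ , Γ-max) (_ , _ , d-min) =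
      d-min (Γ + γ) (ℕₚ.m≤n+m γ Γ) λ k Γ+γ≤k → connected-via-hub D (toHub k Γ+γ≤k)
      where
      toHub : ∀ k → Γ + γ ≤ k → ∀ A → InDk G k A → Walk G k A D
      toHub k Γ+γ≤k A (dA , ∣A∣≤k) =
        let M , M⊆A , mM = minimal-⊆ A dA
            dM = proj₁ mM
            ∣M∪D∣≤k = ≤-trans (∣p∪q∣≤∣p∣+∣q∣ M D)
                        (≤-trans (ℕₚ.+-mono-≤ (Γ-max M mM) (ℕₚ.≤-reflexive ∣D∣≡γ)) Γ+γ≤k)
        in interval dM ∣A∣≤k (M⊆A , ⊆-refl) (⊆-refl , M⊆A)
           ++ʷ bridge dM dD (p⊆p∪q D) (q⊆p∪q M D) ∣M∪D∣≤k

  ¬¬-decidable-adjacency : ¬ ¬ (∀ u v → Dec (Adj u v))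
  ¬¬-decidable-adjacency = ¬¬-∀Fin λ u → ¬¬-∀Fin λ v → ¬¬-excluded-middle

-- The bounds are decidable, so decidability of adjacency may be assumed.
corollary6 : ∀ (n : ℕ) (G : Graph n) → HasTwoDisjointEdges G →
    ∀ (γ Γ d : ℕ) → IsDomNumber G γ → IsUpperDomNumber G Γ → IsD0 G γ d →
    (Γ + 1 ≤ d) × (d ≤ (n ∸ 1) ⊓ (Γ + γ))
corollary6 n G two@(_ , _ , _ , _ , ab , _) γ Γ d iγ iΓ i0 =
  decidable-stable ((Γ + 1 ≤? d) ×-dec (d ≤? (n ∸ 1) ⊓ (Γ + γ))) λ ¬bounds →
    ¬¬-decidable-adjacency G λ adj? →
      let open WithDecidableAdjacency G adj? in
      ¬bounds (Γ<d₀ ab iΓ i0 , ℕₚ.⊓-glb (d₀≤n-1 G two iγ i0) (d₀≤Γ+γ iγ iΓ i0))
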